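{- If $N,n,r,s$ are positive integers with $r>s$ and $\frac{s}{r}>\mathrm{ex}(N,K_n)/\binom{N}{2}$, then $R(n;r,s)\le N$.
   Context: $\mathrm{ex}(N,K_n)$ is the Turán number: the maximum number of edges in a $K_n$-free graph on $N$ vertices. An $(r,s)$-coloring of $K_N$ is a map $\chi:E(K_N)\to\binom{[r]}{s}$; a monochromatic $n$-clique is a set of $n$ vertices such that all edges among them contain a common color. $R(n;r,s)$ is the minimum $N$ such that every $(r,s)$-coloring of $K_N$ contains a monochromatic $n$-clique. -}

module Defs where

open import Data.Nat using (ℕ; zero; suc; _+_; _*_; _≤_; _<_)
open import Data.Nat.Combinatorics using (_C_)
open import Data.Bool using (Bool; true; false; if_then_else_)
open import Data.Fin using (Fin; _<?_)
open import Data.Fin.Subset using (Subset; _∈_; ∣_∣)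
open import Data.List using (List; map; allFin)
open import Data.Nat.ListAction using (sum)
open import Data.Product using (Σ; _×_; ∃-syntax)
open import Relation.Nullary using (¬_; does)
open import Relation.Binary.PropositionalEquality using (_≡_; _≢_)
open import Function.Definitions using (Injective)

record Graph (N : ℕ) : Set where
  field
    adj  : Fin N → Fin N → Bool
    sym  : ∀ i j → adj i j ≡ adj j i
    irr  : ∀ i → adj i i ≡ false
open Graph public

edgeCount : ∀ {N} → Graph N → ℕ
edgeCount {N} G =
  sum (map (λ i → sum (map (λ j →
      if does (i <? j) then (if adj G i j then 1 else 0) else 0)
    (allFin N))) (allFin N))

HasClique : ∀ {N} → ℕ → Graph N → Set
HasClique {N} n G =
  Σ (Fin n → Fin N) λ f → Injective _≡_ _≡_ f ×
    (∀ a b → a ≢ b → adj G (f a) (f b) ≡ true)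

IsTuranNumber : ℕ → ℕ → ℕ → Set
IsTuranNumber N n m =
  (Σ (Graph N) λ G → ¬ HasClique n G × edgeCount G ≡ m) ×
  (∀ (G : Graph N) → ¬ HasClique n G → edgeCount G ≤ m)

record Colouring (N r s : ℕ) : Set where
  field
    col     : Fin N → Fin N → Subset r
    col-sym : ∀ i j → col i j ≡ col j i
    col-size : ∀ i j → i ≢ j → ∣ col i j ∣ ≡ s
open Colouring public

HasMonoClique : ∀ {N r s} → ℕ → Colouring N r s → Set
HasMonoClique {N} {r} n χ =
  Σ (Fin n → Fin N) λ f → Injective _≡_ _≡_ f ×
    Σ (Fin r) λ c → (∀ a b → a ≢ b → c ∈ col χ (f a) (f b))

Arrows : ℕ → ℕ → ℕ → ℕ → Set
Arrows N n r s = ∀ (χ : Colouring N r s) → HasMonoClique n χ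

IsRamseyNumber : ℕ → ℕ → ℕ → ℕ → Set
IsRamseyNumber n r s R = Arrows R n r s × (∀ M → Arrows M n r s → R ≤ M)

{-# OPTIONS --safe #-}
module Submission where

-- For a colouring χ and a colour c, the colour class of c is the graph of the edges whose colour
-- set contains c. Every edge lies in exactly s classes, so the r classes have s·C(N,2) edges in
-- total; if none of them contained a K_n, each would have at most ex(N,K_n) edges and the total
-- would be at most r·ex(N,K_n) < s·C(N,2). So every colouring of K_N has a monochromatic K_n, and
-- since this property of N is decidable (everything is finite), a least such number R(n;r,s) ≤ N
-- exists.

open import Data.Bool using (Bool; true; false; if_then_else_)
import Data.Bool.Properties as Bool
open import Data.Fin using (Fin; zero; suc; _<?_; fromℕ<)
open import Data.Fin.Properties using (_≟_; any?; all?; <⇒≢)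
open import Data.Fin.Subset using (Subset; _∈_; ∣_∣)
open import Data.Fin.Subset.Properties using (_∈?_; anySubset?)
open import Data.List using (allFin; tabulate; map)
open import Data.List.Properties using (map-tabulate; map-cong)
open import Data.Nat using (ℕ; zero; suc; _+_; _*_; _≤_; _<_; z≤n)
open import Data.Nat.Combinatorics using (_C_; nC1≡n; nCk+nC[k+1]≡[n+1]C[k+1])
import Data.Nat.ListAction as List
open import Data.Nat.Properties
  using (+-*-semiring; module ≤-Reasoning; +-mono-≤; *-identityʳ; *-zeroʳ;
         ≤-refl; ≤-pred; ≮⇒≥; ≤⇒≯; m≤n⇒m<n∨m≡n; ≤∧≢⇒<; n≤0⇒n≡0)
  renaming (_≟_ to _≟ℕ_)
open import Algebra.Properties.Semiring.Sum +-*-semiring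
  using (sum-syntax; sum-cong-≗; sum-replicate-zero; ∑-comm; *-distribˡ-sum)
open import Data.Product using (∃; Σ; _×_; _,_; proj₁; proj₂)
import Data.Product as Product
open import Data.Sum using (_⊎_; inj₁; inj₂; [_,_]′)
open import Data.Vec using ([]; _∷_)
open import Data.Vec.Properties using (≡-dec)
import Data.Vec.Functional as Vector
open import Data.Vec.Functional.Relation.Binary.Equality.Setoid using (≋-setoid)
open import Defs hiding (sym)
open import Function using (id; _∘_; mk⇔)
open import Function.Definitions using (Injective)
open import Level using (0ℓ)
open import Relation.Binary.Bundles using (Setoid)
open import Relation.Binary.Definitions using (_Respects_)
open import Relation.Binary.PropositionalEquality
  using (_≡_; _≢_; _≗_; refl; sym; trans; cong; cong₂; subst; setoid; module ≡-Reasoning)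
open import Relation.Nullary using (¬_; Dec; yes; no; does; proof; ofʸ; ofⁿ; contradiction)
open import Relation.Nullary.Decidable
  using (map′; ¬?; _×-dec_; _→-dec_; dec-false; does-⇔; decidable-stable)
open import Relation.Unary using (Pred; Decidable)

-- Searches only for predicates respecting the setoid equality, because without function
-- extensionality a function can only be recovered from its values up to pointwise equality.
Searchable : Setoid 0ℓ 0ℓ → Set₁
Searchable S = ∀ {P : Pred (Setoid.Carrier S) 0ℓ} →
  P Respects (Setoid._≈_ S) → Decidable P → Dec (∃ P)

Bool-searchable : Searchable (setoid Bool)
Bool-searchable _ P? with P? true | P? false
... | yes p | _     = yes (true , p)
... | no _  | yes q = yes (false , q)
... | no ¬p | no ¬q = no λ { (true , p) → ¬p p ; (false , q) → ¬q q }

Fin-searchable : ∀ n → Searchable (setoid (Fin n))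
Fin-searchable n _ = any?

Subset-searchable : ∀ n → Searchable (setoid (Subset n))
Subset-searchable n _ = anySubset?

module _ {S : Setoid 0ℓ 0ℓ} where
  open Setoid S using (_≈_) renaming (refl to ≈-refl)

  Vector-searchable : Searchable S → ∀ n → Searchable (≋-setoid S n)
  Vector-searchable _ zero {P} resp P? =
    map′ (λ p → Vector.[] , p) (λ (v , p) → resp (λ ()) p) (P? Vector.[])
  Vector-searchable search (suc n) {P} resp P? =
    map′ (λ (x , v , p) → x Vector.∷ v , p)
         (λ (v , p) → Vector.head v , Vector.tail v ,
                      resp (λ { zero → ≈-refl ; (suc i) → ≈-refl }) p)
         (search extends-resp extends?)
    where
    extends-resp : (λ x → ∃ λ v → P (x Vector.∷ v)) Respects _≈_
    extends-resp x≈y (v , p) = v , resp (λ { zero → x≈y ; (suc i) → ≈-refl }) p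
    extends? : Decidable (λ x → ∃ λ v → P (x Vector.∷ v))
    extends? x = Vector-searchable search n
      (λ v≋w → resp (λ { zero → ≈-refl ; (suc i) → v≋w i })) (λ v → P? (x Vector.∷ v))

Matrix-searchable : ∀ {S} → Searchable S → ∀ m n → Searchable (≋-setoid (≋-setoid S n) m)
Matrix-searchable {S} search m n =
  Vector-searchable {≋-setoid S n} (Vector-searchable {S} search n) m

∃-injective? : ∀ {n N} {Q : Pred (Fin n → Fin N) 0ℓ} → (∀ {f g} → f ≗ g → Q f → Q g) →
  Decidable Q → Dec (∃ λ f → Injective _≡_ _≡_ f × Q f)
∃-injective? {n} {N} resp Q? =
  Vector-searchable {setoid (Fin N)} (Fin-searchable N) n
    (λ f≗g → Product.map (injective-resp f≗g) (resp f≗g)) (λ f → injective? f ×-dec Q? f)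
  where
  injective? : ∀ (f : Fin n → Fin N) → Dec (Injective _≡_ _≡_ f)
  injective? f = map′ (λ inj {x} {y} → inj x y) (λ inj x y → inj)
    (all? λ x → all? λ y → (f x ≟ f y) →-dec (x ≟ y))
  injective-resp : ∀ {f g : Fin n → Fin N} →
    f ≗ g → Injective _≡_ _≡_ f → Injective _≡_ _≡_ g
  injective-resp f≗g inj {x} {y} gx≡gy = inj (trans (f≗g x) (trans gx≡gy (sym (f≗g y))))

module _ {P : Pred ℕ 0ℓ} (P? : Decidable P) where

  least-or-none : ∀ N → (∃ λ R → P R × (∀ M → P M → R ≤ M)) ⊎ (∀ M → M ≤ N → ¬ P M)
  least-or-none zero with P? zero
  ... | yes p = inj₁ (zero , p , λ _ _ → z≤n)
  ... | no ¬p = inj₂ λ { _ z≤n → ¬p }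
  least-or-none (suc N) with least-or-none N | P? (suc N)
  ... | inj₁ least | _ = inj₁ least
  ... | inj₂ none | yes p =
    inj₁ (suc N , p , λ M pM → ≮⇒≥ λ M<1+N → none M (≤-pred M<1+N) pM)
  ... | inj₂ none | no ¬p = inj₂ λ M M≤1+N →
    [ (λ M<1+N → none M (≤-pred M<1+N)) , (λ { refl → ¬p }) ]′ (m≤n⇒m<n∨m≡n M≤1+N)

  least : ∀ {N} → P N → ∃ λ R → P R × (∀ M → P M → R ≤ M)
  least {N} p = [ id , (λ none → contradiction p (none N ≤-refl)) ]′ (least-or-none N)

  greatest : ∀ B → (∀ k → P k → k ≤ B) → ∀ {k₀} → P k₀ →
    ∃ λ m → P m × (∀ k → P k → k ≤ m)
  greatest B bounded p₀ with P? B
  ... | yes p = B , p , bounded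
  greatest zero bounded {k₀} p₀ | no ¬p =
    contradiction (subst P (n≤0⇒n≡0 (bounded k₀ p₀)) p₀) ¬p
  greatest (suc B) bounded p₀ | no ¬p = greatest B bounded′ p₀
    where
    bounded′ : ∀ k → P k → k ≤ B
    bounded′ k pk = ≤-pred (≤∧≢⇒< (bounded k pk) λ { refl → ¬p pk })

does⇒ : ∀ {A : Set} (a? : Dec A) → does a? ≡ true → A
does⇒ (yes a) _ = a

𝟙 : Bool → ℕ
𝟙 b = if b then 1 else 0

sum-allFin : ∀ n (f : Fin n → ℕ) → List.sum (map f (allFin n)) ≡ ∑[ i < n ] f i
sum-allFin n f = trans (cong List.sum (map-tabulate id f)) (sum-tabulate n f)
  where
  sum-tabulate : ∀ n (f : Fin n → ℕ) → List.sum (tabulate f) ≡ ∑[ i < n ] f i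
  sum-tabulate zero    f = refl
  sum-tabulate (suc n) f = cong (f zero +_) (sum-tabulate n (f ∘ suc))

∑-mono-≤ : ∀ {n} {f g : Fin n → ℕ} → (∀ i → f i ≤ g i) → ∑[ i < n ] f i ≤ ∑[ i < n ] g i
∑-mono-≤ {zero}  f≤g = z≤n
∑-mono-≤ {suc n} f≤g = +-mono-≤ (f≤g zero) (∑-mono-≤ (f≤g ∘ suc))

∑-const : ∀ n k → ∑[ i < n ] k ≡ n * k
∑-const zero    k = refl
∑-const (suc n) k = cong (k +_) (∑-const n k)

∑-𝟙-∈ : ∀ {r} (S : Subset r) → ∑[ c < r ] 𝟙 (does (c ∈? S)) ≡ ∣ S ∣
∑-𝟙-∈ []          = refl
∑-𝟙-∈ (true ∷ S)  = cong suc (∑-𝟙-∈ S)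
∑-𝟙-∈ (false ∷ S) = ∑-𝟙-∈ S

∑∑-𝟙<≡C2 : ∀ N → ∑[ i < N ] ∑[ j < N ] 𝟙 (does (i <? j)) ≡ N C 2
∑∑-𝟙<≡C2 zero    = refl
∑∑-𝟙<≡C2 (suc N) = begin
  ∑[ j < N ] 1 + ∑[ i < N ] ∑[ j < N ] 𝟙 (does (i <? j))
    ≡⟨ cong₂ _+_ (∑-const N 1) (∑∑-𝟙<≡C2 N) ⟩
  N * 1 + N C 2
    ≡⟨ cong (_+ N C 2) (trans (*-identityʳ N) (sym (nC1≡n N))) ⟩
  N C 1 + N C 2
    ≡⟨ nCk+nC[k+1]≡[n+1]C[k+1] N 1 ⟩
  suc N C 2 ∎
  where open ≡-Reasoning

module _ {N : ℕ} where

  _≈ᴳ_ : Graph N → Graph N → Set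
  G ≈ᴳ H = ∀ i j → adj G i j ≡ adj H i j

  Graph-search : ∀ {P : Pred (Graph N) 0ℓ} → (∀ {G H} → G ≈ᴳ H → P G → P H) →
    Decidable P → Dec (∃ P)
  Graph-search {P} resp P? =
    map′ (λ (a , g , p) → toGraph a g , p) fromGraph
         (Matrix-searchable {setoid Bool} Bool-searchable N N graph-resp graph?)
    where
    IsGraph : (Fin N → Fin N → Bool) → Set
    IsGraph a = (∀ i j → a i j ≡ a j i) × (∀ i → a i i ≡ false)
    toGraph : ∀ a → IsGraph a → Graph N
    toGraph a (a-sym , a-irr) = record { adj = a ; sym = a-sym ; irr = a-irr }
    PGraph : Pred (Fin N → Fin N → Bool) 0ℓ
    PGraph a = Σ (IsGraph a) (P ∘ toGraph a)
    fromGraph : ∃ P → ∃ PGraph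
    fromGraph (G , p) = adj G , (Graph.sym G , irr G) , p
    graph-resp : ∀ {a b} → (∀ i j → a i j ≡ b i j) → PGraph a → PGraph b
    graph-resp a≈b ((a-sym , a-irr) , p) =
      ( (λ i j → trans (sym (a≈b i j)) (trans (a-sym i j) (a≈b j i)))
      , (λ i → trans (sym (a≈b i i)) (a-irr i)) ) , resp a≈b p
    graph? : Decidable PGraph
    graph? a with (all? λ i → all? λ j → a i j Bool.≟ a j i) ×-dec (all? λ i → a i i Bool.≟ false)
    ... | yes g = map′ (g ,_) (λ (_ , p) → resp (λ _ _ → refl) p) (P? (toGraph a g))
    ... | no ¬g = no (¬g ∘ proj₁)

  HasClique-resp : ∀ {n G H} → G ≈ᴳ H → HasClique n G → HasClique n H
  HasClique-resp G≈H (f , inj , clique) =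
    f , inj , λ a b a≢b → trans (sym (G≈H _ _)) (clique a b a≢b)

  ¬HasClique-resp : ∀ {n G H} → G ≈ᴳ H → ¬ HasClique n G → ¬ HasClique n H
  ¬HasClique-resp {G = G} {H} G≈H free =
    free ∘ HasClique-resp {G = H} {G} (λ i j → sym (G≈H i j))

  HasClique? : ∀ n (G : Graph N) → Dec (HasClique n G)
  HasClique? n G = ∃-injective? resp
    (λ f → all? λ a → all? λ b → ¬? (a ≟ b) →-dec (adj G (f a) (f b) Bool.≟ true))
    where
    resp : ∀ {f g : Fin n → Fin N} → f ≗ g →
      (∀ a b → a ≢ b → adj G (f a) (f b) ≡ true) →
      (∀ a b → a ≢ b → adj G (g a) (g b) ≡ true)
    resp f≗g clique a b a≢b = trans (cong₂ (adj G) (sym (f≗g a)) (sym (f≗g b))) (clique a b a≢b)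

  edgeTerm : Graph N → Fin N → Fin N → ℕ
  edgeTerm G i j = if does (i <? j) then 𝟙 (adj G i j) else 0

  edgeCount-∑ : ∀ G → edgeCount G ≡ ∑[ i < N ] ∑[ j < N ] edgeTerm G i j
  edgeCount-∑ G = trans (cong List.sum (map-cong (λ i → sum-allFin N (edgeTerm G i)) (allFin N)))
                         (sum-allFin N _)

  edgeCount-resp : ∀ {G H} → G ≈ᴳ H → edgeCount G ≡ edgeCount H
  edgeCount-resp {G} {H} G≈H = begin
    edgeCount G                          ≡⟨ edgeCount-∑ G ⟩
    ∑[ i < N ] ∑[ j < N ] edgeTerm G i j ≡⟨ sum-cong-≗ (λ i → sum-cong-≗ (same-term i)) ⟩
    ∑[ i < N ] ∑[ j < N ] edgeTerm H i j ≡⟨ edgeCount-∑ H ⟨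
    edgeCount H                          ∎
    where
    open ≡-Reasoning
    same-term : ∀ i j → edgeTerm G i j ≡ edgeTerm H i j
    same-term i j = cong (λ b → if does (i <? j) then 𝟙 b else 0) (G≈H i j)

  edgeCount≤C2 : ∀ G → edgeCount G ≤ N C 2
  edgeCount≤C2 G = begin
    edgeCount G                                ≡⟨ edgeCount-∑ G ⟩
    ∑[ i < N ] ∑[ j < N ] edgeTerm G i j       ≤⟨ ∑-mono-≤ (λ i → ∑-mono-≤ (edgeTerm≤ i)) ⟩
    ∑[ i < N ] ∑[ j < N ] 𝟙 (does (i <? j))    ≡⟨ ∑∑-𝟙<≡C2 N ⟩
    N C 2                                      ∎
    where
    open ≤-Reasoning
    edgeTerm≤ : ∀ i j → edgeTerm G i j ≤ 𝟙 (does (i <? j))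
    edgeTerm≤ i j with does (i <? j) | adj G i j
    ... | true  | true  = ≤-refl
    ... | true  | false = z≤n
    ... | false | _     = z≤n

  turán-number-exists : ∀ {n} → (∃ λ G → ¬ HasClique n G) → ∃ (IsTuranNumber N n)
  turán-number-exists {n} (G₀ , G₀-free) =
    let m , extremal , maximal = greatest attained? (N C 2) bounded (G₀ , G₀-free , refl)
    in  m , extremal , λ G free → maximal (edgeCount G) (G , free , refl)
    where
    Attained : Pred ℕ 0ℓ
    Attained k = ∃ λ G → ¬ HasClique n G × edgeCount G ≡ k
    attained? : Decidable Attained
    attained? k = Graph-search
      (λ {G} {H} G≈H (free , count) →
        ¬HasClique-resp {G = G} {H} G≈H free , trans (sym (edgeCount-resp {G} {H} G≈H)) count)
      (λ G → ¬? (HasClique? n G) ×-dec (edgeCount G ≟ℕ k))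
    bounded : ∀ k → Attained k → k ≤ N C 2
    bounded _ (G , _ , refl) = edgeCount≤C2 G

module _ {N r s : ℕ} where

  _≈ᶜ_ : Colouring N r s → Colouring N r s → Set
  χ ≈ᶜ ψ = ∀ i j → col χ i j ≡ col ψ i j

  Colouring-search : ∀ {P : Pred (Colouring N r s) 0ℓ} → (∀ {χ ψ} → χ ≈ᶜ ψ → P χ → P ψ) →
    Decidable P → Dec (∃ P)
  Colouring-search {P} resp P? =
    map′ (λ (κ , k , p) → toColouring κ k , p) fromColouring
         (Matrix-searchable {setoid (Subset r)} (Subset-searchable r) N N
                            colouring-resp colouring?)
    where
    IsColouring : (Fin N → Fin N → Subset r) → Set
    IsColouring κ = (∀ i j → κ i j ≡ κ j i) × (∀ i j → i ≢ j → ∣ κ i j ∣ ≡ s)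
    toColouring : ∀ κ → IsColouring κ → Colouring N r s
    toColouring κ (κ-sym , κ-size) =
      record { col = κ ; col-sym = κ-sym ; col-size = κ-size }
    PColouring : Pred (Fin N → Fin N → Subset r) 0ℓ
    PColouring κ = Σ (IsColouring κ) (P ∘ toColouring κ)
    fromColouring : ∃ P → ∃ PColouring
    fromColouring (χ , p) = col χ , (col-sym χ , col-size χ) , p
    colouring-resp : ∀ {κ κ′} → (∀ i j → κ i j ≡ κ′ i j) → PColouring κ → PColouring κ′
    colouring-resp κ≈κ′ ((κ-sym , κ-size) , p) =
      ( (λ i j → trans (sym (κ≈κ′ i j)) (trans (κ-sym i j) (κ≈κ′ j i)))
      , (λ i j i≢j → trans (cong ∣_∣ (sym (κ≈κ′ i j))) (κ-size i j i≢j)) ) , resp κ≈κ′ p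
    colouring? : Decidable PColouring
    colouring? κ with (all? λ i → all? λ j → ≡-dec Bool._≟_ (κ i j) (κ j i))
                  ×-dec (all? λ i → all? λ j → ¬? (i ≟ j) →-dec (∣ κ i j ∣ ≟ℕ s))
    ... | yes k = map′ (k ,_) (λ (_ , p) → resp (λ _ _ → refl) p) (P? (toColouring κ k))
    ... | no ¬k = no (¬k ∘ proj₁)

  HasMonoClique-resp : ∀ {n χ ψ} → χ ≈ᶜ ψ → HasMonoClique n χ → HasMonoClique n ψ
  HasMonoClique-resp χ≈ψ (f , inj , c , mono) =
    f , inj , c , λ a b a≢b → subst (c ∈_) (χ≈ψ _ _) (mono a b a≢b)

  ¬HasMonoClique-resp : ∀ {n χ ψ} → χ ≈ᶜ ψ → ¬ HasMonoClique n χ → ¬ HasMonoClique n ψ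
  ¬HasMonoClique-resp {χ = χ} {ψ} χ≈ψ ¬mono =
    ¬mono ∘ HasMonoClique-resp {χ = ψ} {χ} (λ i j → sym (χ≈ψ i j))

  HasMonoClique? : ∀ n (χ : Colouring N r s) → Dec (HasMonoClique n χ)
  HasMonoClique? n χ = ∃-injective? resp
    (λ f → any? λ c → all? λ a → all? λ b → ¬? (a ≟ b) →-dec (c ∈? col χ (f a) (f b)))
    where
    resp : ∀ {f g : Fin n → Fin N} → f ≗ g →
      (∃ λ c → ∀ a b → a ≢ b → c ∈ col χ (f a) (f b)) →
      (∃ λ c → ∀ a b → a ≢ b → c ∈ col χ (g a) (g b))
    resp f≗g (c , mono) =
      c , λ a b a≢b → subst (c ∈_) (cong₂ (col χ) (f≗g a) (f≗g b)) (mono a b a≢b)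

  Arrows? : ∀ n → Dec (Arrows N n r s)
  Arrows? n with Colouring-search (λ {χ} {ψ} → ¬HasMonoClique-resp {n} {χ} {ψ})
                                  (λ χ → ¬? (HasMonoClique? n χ))
  ... | yes (χ , ¬mono) = no λ arrows → ¬mono (arrows χ)
  ... | no ∄¬mono = yes λ χ → decidable-stable (HasMonoClique? n χ) (∄¬mono ∘ (χ ,_))

module _ {N r s : ℕ} (χ : Colouring N r s) where

  adjacent? : ∀ c i j → Dec (i ≢ j × c ∈ col χ i j)
  adjacent? c i j = ¬? (i ≟ j) ×-dec c ∈? col χ i j

  colourClass : Fin r → Graph N
  colourClass c = record
    { adj = λ i j → does (adjacent? c i j)
    ; sym = λ i j → does-⇔ (mk⇔ (swap (col-sym χ i j)) (swap (col-sym χ j i)))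
                           (adjacent? c i j) (adjacent? c j i)
    ; irr = λ i → dec-false (adjacent? c i i) λ (i≢i , _) → i≢i refl
    }
    where
    swap : ∀ {i j} → col χ i j ≡ col χ j i → i ≢ j × c ∈ col χ i j → j ≢ i × c ∈ col χ j i
    swap eq (i≢j , c∈) = (λ j≡i → i≢j (sym j≡i)) , subst (c ∈_) eq c∈

  colourClass-adj : ∀ c {i j} → i ≢ j → adj (colourClass c) i j ≡ does (c ∈? col χ i j)
  colourClass-adj c {i} {j} i≢j = does-⇔ (mk⇔ proj₂ (i≢j ,_)) (adjacent? c i j) (c ∈? col χ i j)

  colourClass-clique⇒mono : ∀ {n} c → HasClique n (colourClass c) → HasMonoClique n χ
  colourClass-clique⇒mono c (f , inj , clique) =
    f , inj , c , λ a b a≢b → proj₂ (does⇒ (adjacent? c (f a) (f b)) (clique a b a≢b))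

  ∑-edgeCount-colourClass : ∑[ c < r ] edgeCount (colourClass c) ≡ s * (N C 2)
  ∑-edgeCount-colourClass = begin
    ∑[ c < r ] edgeCount (colourClass c)
      ≡⟨ sum-cong-≗ (edgeCount-∑ ∘ colourClass) ⟩
    ∑[ c < r ] ∑[ i < N ] ∑[ j < N ] edgeTerm (colourClass c) i j
      ≡⟨ ∑-comm (λ c i → ∑[ j < N ] edgeTerm (colourClass c) i j) ⟩
    ∑[ i < N ] ∑[ c < r ] ∑[ j < N ] edgeTerm (colourClass c) i j
      ≡⟨ sum-cong-≗ (λ i → ∑-comm (λ c j → edgeTerm (colourClass c) i j)) ⟩
    ∑[ i < N ] ∑[ j < N ] ∑[ c < r ] edgeTerm (colourClass c) i j
      ≡⟨ sum-cong-≗ (λ i → sum-cong-≗ (pair-in-s-classes i)) ⟩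
    ∑[ i < N ] ∑[ j < N ] (s * 𝟙 (does (i <? j)))
      ≡⟨ sum-cong-≗ {N} (λ i → sym (*-distribˡ-sum {N} s (λ j → 𝟙 (does (i <? j))))) ⟩
    ∑[ i < N ] (s * ∑[ j < N ] 𝟙 (does (i <? j)))
      ≡⟨ sym (*-distribˡ-sum {N} s (λ i → ∑[ j < N ] 𝟙 (does (i <? j)))) ⟩
    s * ∑[ i < N ] ∑[ j < N ] 𝟙 (does (i <? j))
      ≡⟨ cong (s *_) (∑∑-𝟙<≡C2 N) ⟩
    s * (N C 2) ∎
    where
    open ≡-Reasoning
    pair-in-s-classes : ∀ i j →
      ∑[ c < r ] (if does (i <? j) then 𝟙 (adj (colourClass c) i j) else 0) ≡
      s * 𝟙 (does (i <? j))
    pair-in-s-classes i j with does (i <? j) | proof (i <? j)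
    ... | true | ofʸ i<j = begin
      ∑[ c < r ] 𝟙 (adj (colourClass c) i j)
        ≡⟨ sum-cong-≗ (λ c → cong 𝟙 (colourClass-adj c (<⇒≢ i<j))) ⟩
      ∑[ c < r ] 𝟙 (does (c ∈? col χ i j))
        ≡⟨ ∑-𝟙-∈ (col χ i j) ⟩
      ∣ col χ i j ∣
        ≡⟨ col-size χ i j (<⇒≢ i<j) ⟩
      s
        ≡⟨ *-identityʳ s ⟨
      s * 1 ∎
    ... | false | ofⁿ _ = trans (sum-replicate-zero r) (sym (*-zeroʳ s))

turán-bound⇒arrows : ∀ {N n r s m} → IsTuranNumber N n m → r * m < s * (N C 2) → Arrows N n r s
turán-bound⇒arrows {N} {n} {r} {s} {m} (_ , extremal) r*m<s*C χ
  with any? (λ c → HasClique? n (colourClass χ c))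
... | yes (c , clique) = colourClass-clique⇒mono χ c clique
... | no no-clique = contradiction r*m<s*C (≤⇒≯ (begin
  s * (N C 2)                            ≡⟨ ∑-edgeCount-colourClass χ ⟨
  ∑[ c < r ] edgeCount (colourClass χ c) ≤⟨ ∑-mono-≤ class-bound ⟩
  ∑[ c < r ] m                           ≡⟨ ∑-const r m ⟩
  r * m                                  ∎))
  where
  open ≤-Reasoning
  class-bound : ∀ c → edgeCount (colourClass χ c) ≤ m
  class-bound c = extremal (colourClass χ c) (no-clique ∘ (c ,_))

turán-condition⇒arrows : ∀ {N n r s} → 1 ≤ r →
  (∀ m → IsTuranNumber N n m → r * m < s * (N C 2)) → Arrows N n r s
turán-condition⇒arrows {N} {n} 1≤r condition
  with Graph-search (λ {G} {H} → ¬HasClique-resp {n = n} {G} {H}) (λ G → ¬? (HasClique? n G))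
... | yes K-free =
  let m , turán = turán-number-exists K-free in turán-bound⇒arrows turán (condition m turán)
-- No graph on N vertices is K_n-free, so ex(N, K_n) does not exist; any colour class has a K_n.
... | no ∄K-free = λ χ →
  let G = colourClass χ (fromℕ< 1≤r)
  in  colourClass-clique⇒mono χ (fromℕ< 1≤r)
        (decidable-stable (HasClique? n G) λ ¬clique → ∄K-free (G , ¬clique))

proposition4p1 : ∀ (N n r s : ℕ) → 1 ≤ N → 1 ≤ n → 1 ≤ r → 1 ≤ s → s < r →
    (∀ m → IsTuranNumber N n m → r * m < s * (N C 2)) →
    Σ ℕ λ R → IsRamseyNumber n r s R × R ≤ N
proposition4p1 N n r s _ _ 1≤r _ _ condition =
  let R , arrows-R , minimal = least (λ M → Arrows? {M} {r} {s} n) arrows-N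
  in  R , (arrows-R , minimal) , minimal N arrows-N
  where
  arrows-N : Arrows N n r s
  arrows-N = turán-condition⇒arrows 1≤r condition
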